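{- Let $\pi\in\mathcal D(n)$ have bounce composition $\alpha$ with bounce points $b_0,\dots,b_m$, and suppose $\alpha_i>\alpha_{i+1}$ for some $1\le i<m$; let $\delta=\alpha_i-\alpha_{i+1}$. Suppose $\pi$ passes through the point $A=(b_{i-1},b_{i-1}+\alpha_{i+1})$ and from there takes the steps $\mathsf N^{\delta}\mathsf E^{\alpha_i}\mathsf N^{\alpha_{i+1}}$, reaching $B=(b_i,b_{i+1})$. Then $\pi\cdot S_i^p\neq\bot$ for all $1\le p\le\delta$. Moreover, $\pi'=\pi\cdot S_i^{\delta}$ is obtained from $\pi$ by replacing its portion between $A$ and $B$ with $\mathsf E^{\alpha_{i+1}}\mathsf N^{\alpha_i}\mathsf E^{\delta}$ and leaving the rest of the path unchanged, and $\pi'$ has bounce path $p_{n,(\alpha_1,\dots,\alpha_{i-1},\alpha_{i+1},\alpha_i,\alpha_{i+2},\dots,\alpha_m)}$.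
   Context: A Dyck path of semilength $n$ is a lattice path from $(0,0)$ to $(n,n)$ with unit north steps $\mathsf N$ and east steps $\mathsf E$ never going below $y=x$; $\mathcal D(n)$ is their set. Row $j$ is the strip $j-1\le y\le j$, column $i$ the strip $i-1\le x\le i$. For a path let $x_j$ be the $x$-coordinate of its north step in row $j$ and $h_i$ the $y$-coordinate of its east step in column $i$; set $h_0=0$. Bounce points: $b_0=0$, $b_k=h_{b_{k-1}+1}$ for $k\ge1$ until $b_m=n$; bounce composition $\alpha=(\alpha_1,\dots,\alpha_m)$, $\alpha_k=b_k-b_{k-1}$; bounce path $p_{n,\alpha}=\mathsf N^{\alpha_1}\mathsf E^{\alpha_1}\cdots\mathsf N^{\alpha_m}\mathsf E^{\alpha_m}$. Operators act on the right on $\mathcal D(n)\cup\{\bot\}$, composed left to right, fixing $\bot$; $X^{ -k}=(X^{ -1})^k$, $X^p$ is $p$-fold application. $A_i$ / $A_i^{ -1}$ replace $x_i$ by $x_i\mp1$; $C_i$ / $C_i^{ -1}$ replace $h_i$ by $h_i\pm1$; result $\bot$ if not a Dyck path. For a path with bounce points $b_0,\dots,b_m$ and $1\le i\le m-1$, with $s=b_{i+1}-h_{b_i}$: $\pi\cdot S_i=\bot$ if $h_{b_{i-1}}=b_i$, else $\pi\cdot A_{b_i}^{ -s}C_{b_i}^{s}$; in $S_i^p$ each application uses the bounce points of the path it is applied to. -}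

module Defs where

open import Data.Nat using (ℕ; zero; suc; _+_; _∸_; _≡ᵇ_)
open import Data.Nat.Properties using () renaming (_≟_ to _≟ℕ_)
open import Data.Bool using (Bool; true; false; _∧_; if_then_else_)
open import Data.List using (List; []; _∷_; _++_; replicate; concatMap; length)
open import Data.List.Properties using (≡-dec)
open import Data.Maybe using (Maybe; just; nothing; _>>=_) renaming (map to mapMaybe)
open import Relation.Nullary using (does)
open import Relation.Binary.PropositionalEquality using (_≡_)

-- Steps of a lattice path: N = (0,1), E = (1,0).
data Step : Set where
  N E : Step

Path : Set
Path = List Step

countN : Path → ℕ
countN []      = 0
countN (N ∷ r) = suc (countN r)
countN (E ∷ r) = countN r

countE : Path → ℕ
countE []      = 0
countE (N ∷ r) = countE r
countE (E ∷ r) = suc (countE r)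

-- never goes below y = x, starting with excess d (= y - x), ending on the diagonal
validFrom : ℕ → Path → Bool
validFrom zero    []      = true
validFrom (suc _) []      = false
validFrom d       (N ∷ r) = validFrom (suc d) r
validFrom zero    (E ∷ r) = false
validFrom (suc d) (E ∷ r) = validFrom d r

isDyck : ℕ → Path → Bool
isDyck n π = (countN π ≡ᵇ n) ∧ validFrom 0 π

IsDyck : ℕ → Path → Set
IsDyck n π = isDyck n π ≡ true


-- x-coordinates of the north steps: xs π = (x_1, …, x_n)
xsFrom : ℕ → Path → List ℕ
xsFrom e []      = []
xsFrom e (N ∷ r) = e ∷ xsFrom e r
xsFrom e (E ∷ r) = xsFrom (suc e) r

xs : Path → List ℕ
xs = xsFrom 0

-- y-coordinates of the east steps: hs π = (h_1, …, h_n)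
hsFrom : ℕ → Path → List ℕ
hsFrom k []      = []
hsFrom k (N ∷ r) = hsFrom (suc k) r
hsFrom k (E ∷ r) = k ∷ hsFrom k r

hs : Path → List ℕ
hs = hsFrom 0

-- 0-indexed lookup with default 0
at : List ℕ → ℕ → ℕ
at []       _       = 0
at (x ∷ _)  zero    = x
at (_ ∷ r)  (suc k) = at r k

-- h_j (1-indexed), with h_0 = 0
hAt : Path → ℕ → ℕ
hAt π zero    = 0
hAt π (suc j) = at (hs π) j

fromXFrom : ℕ → ℕ → List ℕ → Path
fromXFrom n cur []      = replicate (n ∸ cur) E
fromXFrom n cur (x ∷ r) = replicate (x ∸ cur) E ++ (N ∷ fromXFrom n x r)

fromX : ℕ → List ℕ → Path
fromX n = fromXFrom n 0

fromHFrom : ℕ → ℕ → List ℕ → Path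
fromHFrom n cur []      = replicate (n ∸ cur) N
fromHFrom n cur (h ∷ r) = replicate (h ∸ cur) N ++ (E ∷ fromHFrom n h r)

fromH : ℕ → List ℕ → Path
fromH n = fromHFrom n 0

dyckWithX : ℕ → List ℕ → Maybe Path
dyckWithX n v =
  let c = fromX n v in
  if does (≡-dec _≟ℕ_ (xs c) v) ∧ isDyck n c then just c else nothing

dyckWithH : ℕ → List ℕ → Maybe Path
dyckWithH n v =
  let c = fromH n v in
  if does (≡-dec _≟ℕ_ (hs c) v) ∧ isDyck n c then just c else nothing

modAt : ℕ → (ℕ → Maybe ℕ) → List ℕ → Maybe (List ℕ)
modAt _       f []      = nothing
modAt zero    f (x ∷ r) = mapMaybe (_∷ r) (f x)
modAt (suc k) f (x ∷ r) = mapMaybe (x ∷_) (modAt k f r)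

-- modify the entry at 1-indexed position i
mod1 : ℕ → (ℕ → Maybe ℕ) → List ℕ → Maybe (List ℕ)
mod1 zero    f v = nothing
mod1 (suc k) f v = modAt k f v

decr : ℕ → Maybe ℕ
decr zero    = nothing
decr (suc k) = just k

incr : ℕ → Maybe ℕ
incr k = just (suc k)

-- Operators (nothing = ⊥), for paths of semilength n.
-- A_i : x_i ↦ x_i - 1 ;  A_i⁻¹ : x_i ↦ x_i + 1
A : ℕ → ℕ → Path → Maybe Path
A n i π = mod1 i decr (xs π) >>= dyckWithX n

Ainv : ℕ → ℕ → Path → Maybe Path
Ainv n i π = mod1 i incr (xs π) >>= dyckWithX n

-- C_i : h_i ↦ h_i + 1 ;  C_i⁻¹ : h_i ↦ h_i - 1
C : ℕ → ℕ → Path → Maybe Path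
C n i π = mod1 i incr (hs π) >>= dyckWithH n

Cinv : ℕ → ℕ → Path → Maybe Path
Cinv n i π = mod1 i decr (hs π) >>= dyckWithH n

iter : ℕ → (Path → Maybe Path) → Maybe Path → Maybe Path
iter zero    f m = m
iter (suc p) f m = iter p f (m >>= f)

bounceFrom : ℕ → ℕ → Path → ℕ → List ℕ
bounceFrom zero     n π b = []
bounceFrom (suc fu) n π b =
  if b ≡ᵇ n then [] else
  (let b' = hAt π (suc b) in b' ∷ bounceFrom fu n π b')

bouncePoints : ℕ → Path → List ℕ
bouncePoints n π = 0 ∷ bounceFrom n n π 0

diffs : List ℕ → List ℕ
diffs (b ∷ b' ∷ r) = (b' ∸ b) ∷ diffs (b' ∷ r)
diffs _            = []

bounceComp : ℕ → Path → List ℕ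
bounceComp n π = diffs (bouncePoints n π)

pathOfComp : List ℕ → Path
pathOfComp = concatMap (λ a → replicate a N ++ replicate a E)

bouncePath : ℕ → Path → Path
bouncePath n π = pathOfComp (bounceComp n π)

-- S_i (1 ≤ i ≤ m-1); outside this range we set π · S_i = ⊥
S : ℕ → ℕ → Path → Maybe Path
S n i π =
  let bs = bouncePoints n π
      m  = length bs ∸ 1
      bim1 = at bs (i ∸ 1)
      bi   = at bs i
      bip1 = at bs (suc i)
      s    = bip1 ∸ hAt π bi
  in if (i ≡ᵇ 0) then nothing else
     if (m ∸ i ≡ᵇ 0) then nothing else
     if (hAt π bim1 ≡ᵇ bi) then nothing else
     iter s (C n bi) (iter s (Ainv n bi) (just π))

{-# OPTIONS --safe #-}
module Submission where

-- Write β = b_{i-1}, c = α_{i+1}, κ = β + c (so A = (β, κ)) and, for r + k = δ,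
--   P r k = pre N^r E^c N^k E^r N^c E^k post,
-- so that π = P δ 0 and the claimed π' is P 0 δ. All P r k have the same east-step heights
-- outside the columns β+1, …, β+c+δ; inside, column β+1 has height r + κ and column r+κ+1 has
-- height b_{i+1} = κ + δ + c. Hence the bounce points of P r k are those of π with b_i replaced
-- by r + κ. In P (1+r) k the operator S_i therefore has s = b_{i+1} − h_{b_i} = c: A_{b_i}^{-c}
-- slides the last north step of N^{1+r} across E^c, and C_{b_i}^c then lifts the last east step
-- of E^{1+r} across N^c, which gives P r (1+k). So S_i^p π = P (δ − p) p for p ≤ δ, and the
-- bounce composition of P 0 δ is that of π with α_i, α_{i+1} replaced by κ − β = c and
-- b_{i+1} − κ = α_i.

open import Defs
open import Data.Nat using (ℕ; zero; suc; _+_; _∸_; _≤_; _<_; _≡ᵇ_; z≤n; s≤s)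
open import Data.Nat.Properties
open import Data.Nat.Tactic.RingSolver using (solve-∀)
open import Data.List using (List; []; _∷_; _++_; [_]; replicate; length; take; drop)
open import Data.List.Properties using (++-assoc; ++-identityʳ; ≡-dec)
open import Data.Maybe using (Maybe; just; nothing; _>>=_) renaming (map to maybeMap)
open import Data.Product using (_×_; _,_; proj₁; proj₂)
open import Data.Bool using (true; false; T)
open import Function using (_∘_)
open import Relation.Nullary using (contradiction)
open import Relation.Nullary.Decidable using (dec-true; dec-false)
open import Relation.Binary.PropositionalEquality hiding ([_])
open ≡-Reasoning

≢⇒≡ᵇ-false : ∀ {m n} → m ≢ n → (m ≡ᵇ n) ≡ false
≢⇒≡ᵇ-false {m} {n} = dec-false (m ≟ n)

≡ᵇ-false⇒≢ : ∀ {m n} → (m ≡ᵇ n) ≡ false → m ≢ n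
≡ᵇ-false⇒≢ {m} e refl = subst T e (≡⇒≡ᵇ m m refl)

isDyck⇒countN : ∀ {n} π → IsDyck n π → countN π ≡ n
isDyck⇒countN {n} π d with countN π ≡ᵇ n in eq
... | true = ≡ᵇ⇒≡ (countN π) n (subst T (sym eq) _)

isDyck⇒valid : ∀ {n} π → IsDyck n π → validFrom 0 π ≡ true
isDyck⇒valid {n} π d with countN π ≡ᵇ n
... | true = d

isDyck-intro : ∀ {n} π → countN π ≡ n → validFrom 0 π ≡ true → IsDyck n π
isDyck-intro {n} π e v rewrite dec-true (countN π ≟ n) e | v = refl

replicate-snoc : ∀ {A : Set} m (x : A) q → replicate (suc m) x ++ q ≡ replicate m x ++ x ∷ q
replicate-snoc zero    x q = refl
replicate-snoc (suc m) x q = cong (x ∷_) (replicate-snoc m x q)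

replicate-+-++ : ∀ {A : Set} m k (x : A) q → replicate (m + k) x ++ q ≡ replicate m x ++ replicate k x ++ q
replicate-+-++ zero    k x q = refl
replicate-+-++ (suc m) k x q = cong (x ∷_) (replicate-+-++ m k x q)

++-assoc₄ : ∀ {A : Set} (a b c d q : List A) → (a ++ b ++ c ++ d) ++ q ≡ a ++ b ++ c ++ d ++ q
++-assoc₄ a b c d q = begin
  (a ++ b ++ c ++ d) ++ q   ≡⟨ ++-assoc a _ q ⟩
  a ++ (b ++ c ++ d) ++ q   ≡⟨ cong (a ++_) (++-assoc b _ q) ⟩
  a ++ b ++ (c ++ d) ++ q   ≡⟨ cong (λ t → a ++ b ++ t) (++-assoc c d q) ⟩
  a ++ b ++ c ++ d ++ q     ∎

at-++ˡ : ∀ (l r : List ℕ) {j} → j < length l → at (l ++ r) j ≡ at l j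
at-++ˡ (x ∷ l) r {zero}  _         = refl
at-++ˡ (x ∷ l) r {suc j} (s≤s j<l) = at-++ˡ l r j<l

at-++ʳ : ∀ (l r : List ℕ) j → at (l ++ r) (length l + j) ≡ at r j
at-++ʳ []      r j = refl
at-++ʳ (x ∷ l) r j = at-++ʳ l r j

at-replicate-++ˡ : ∀ m x (r : List ℕ) {j} → j < m → at (replicate m x ++ r) j ≡ x
at-replicate-++ˡ (suc m) x r {zero}  _         = refl
at-replicate-++ˡ (suc m) x r {suc j} (s≤s j<m) = at-replicate-++ˡ m x r j<m

at-replicate-++ʳ : ∀ m x (r : List ℕ) j → at (replicate m x ++ r) (m + j) ≡ at r j
at-replicate-++ʳ zero    x r j = refl
at-replicate-++ʳ (suc m) x r j = at-replicate-++ʳ m x r j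

setAt : ℕ → ℕ → List ℕ → List ℕ
setAt _       v []      = []
setAt zero    v (x ∷ l) = v ∷ l
setAt (suc k) v (x ∷ l) = x ∷ setAt k v l

length-setAt : ∀ k v (l : List ℕ) → length (setAt k v l) ≡ length l
length-setAt k       v []      = refl
length-setAt zero    v (x ∷ l) = refl
length-setAt (suc k) v (x ∷ l) = cong suc (length-setAt k v l)

at-setAt-≡ : ∀ k v (l : List ℕ) → k < length l → at (setAt k v l) k ≡ v
at-setAt-≡ zero    v (x ∷ l) _         = refl
at-setAt-≡ (suc k) v (x ∷ l) (s≤s k<l) = at-setAt-≡ k v l k<l

at-setAt-≢ : ∀ k v (l : List ℕ) {j} → j ≢ k → at (setAt k v l) j ≡ at l j
at-setAt-≢ k       v []      j≢k = refl
at-setAt-≢ zero    v (x ∷ l) {zero}  j≢k = contradiction refl j≢k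
at-setAt-≢ zero    v (x ∷ l) {suc j} j≢k = refl
at-setAt-≢ (suc k) v (x ∷ l) {zero}  j≢k = refl
at-setAt-≢ (suc k) v (x ∷ l) {suc j} j≢k = at-setAt-≢ k v l (j≢k ∘ cong suc)

at-diffs : ∀ (l : List ℕ) {j} → suc j < length l → at (diffs l) j ≡ at l (suc j) ∸ at l j
at-diffs (x ∷ [])    {zero}  (s≤s ())
at-diffs (x ∷ y ∷ l) {zero}  _         = refl
at-diffs (x ∷ y ∷ l) {suc j} (s≤s j<l) = at-diffs (y ∷ l) j<l

length-diffs : ∀ (l : List ℕ) {j} → j < length (diffs l) → suc j < length l
length-diffs (x ∷ y ∷ l) {zero}  _         = s≤s (s≤s z≤n)
length-diffs (x ∷ y ∷ l) {suc j} (s≤s j<l) = s≤s (length-diffs (y ∷ l) j<l)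

diffs-setAt : ∀ i v (l : List ℕ) → suc (suc i) < length l →
  diffs (setAt (suc i) v l) ≡
    take i (diffs l) ++ (v ∸ at l i) ∷ (at l (suc (suc i)) ∸ v) ∷ drop (suc (suc i)) (diffs l)
diffs-setAt i       v (x ∷ [])          (s≤s ())
diffs-setAt i       v (x ∷ y ∷ [])      (s≤s (s≤s ()))
diffs-setAt zero    v (x ∷ y ∷ z ∷ l) _         = refl
diffs-setAt (suc i) v (x ∷ y ∷ z ∷ l) (s≤s i<l) = cong ((y ∸ x) ∷_) (diffs-setAt i v (y ∷ z ∷ l) i<l)

countN-++ : ∀ p q → countN (p ++ q) ≡ countN p + countN q
countN-++ []      q = refl
countN-++ (N ∷ p) q = cong suc (countN-++ p q)
countN-++ (E ∷ p) q = countN-++ p q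

countE-++ : ∀ p q → countE (p ++ q) ≡ countE p + countE q
countE-++ []      q = refl
countE-++ (N ∷ p) q = countE-++ p q
countE-++ (E ∷ p) q = cong suc (countE-++ p q)

countN-replicateN : ∀ m → countN (replicate m N) ≡ m
countN-replicateN zero    = refl
countN-replicateN (suc m) = cong suc (countN-replicateN m)

countN-replicateE : ∀ m → countN (replicate m E) ≡ 0
countN-replicateE zero    = refl
countN-replicateE (suc m) = countN-replicateE m

countE-replicateN : ∀ m → countE (replicate m N) ≡ 0
countE-replicateN zero    = refl
countE-replicateN (suc m) = countE-replicateN m

countE-replicateE : ∀ m → countE (replicate m E) ≡ m
countE-replicateE zero    = refl
countE-replicateE (suc m) = cong suc (countE-replicateE m)

countN-replicateN-++ : ∀ m q → countN (replicate m N ++ q) ≡ m + countN q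
countN-replicateN-++ zero    q = refl
countN-replicateN-++ (suc m) q = cong suc (countN-replicateN-++ m q)

countN-replicateE-++ : ∀ m q → countN (replicate m E ++ q) ≡ countN q
countN-replicateE-++ zero    q = refl
countN-replicateE-++ (suc m) q = countN-replicateE-++ m q

countE-replicateN-++ : ∀ m q → countE (replicate m N ++ q) ≡ countE q
countE-replicateN-++ zero    q = refl
countE-replicateN-++ (suc m) q = countE-replicateN-++ m q

countE-replicateE-++ : ∀ m q → countE (replicate m E ++ q) ≡ m + countE q
countE-replicateE-++ zero    q = refl
countE-replicateE-++ (suc m) q = cong suc (countE-replicateE-++ m q)

validFrom-N∷ : ∀ d p → validFrom d (N ∷ p) ≡ validFrom (suc d) p
validFrom-N∷ zero    p = refl
validFrom-N∷ (suc d) p = refl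

validFrom-replicateN-++ : ∀ m d q → validFrom d (replicate m N ++ q) ≡ validFrom (m + d) q
validFrom-replicateN-++ zero    d q = refl
validFrom-replicateN-++ (suc m) d q = begin
  validFrom d (N ∷ replicate m N ++ q)   ≡⟨ validFrom-N∷ d _ ⟩
  validFrom (suc d) (replicate m N ++ q) ≡⟨ validFrom-replicateN-++ m (suc d) q ⟩
  validFrom (m + suc d) q                ≡⟨ cong (λ e → validFrom e q) (+-suc m d) ⟩
  validFrom (suc m + d) q                ∎

validFrom-replicateE-++ : ∀ m d q → validFrom (m + d) (replicate m E ++ q) ≡ validFrom d q
validFrom-replicateE-++ zero    d q = refl
validFrom-replicateE-++ (suc m) d q = validFrom-replicateE-++ m d q

validFrom⇒balanced : ∀ d p → validFrom d p ≡ true → d + countN p ≡ countE p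
validFrom⇒balanced zero    []      _ = refl
validFrom⇒balanced d       (N ∷ p) v = begin
  d + suc (countN p) ≡⟨ +-suc d (countN p) ⟩
  suc d + countN p   ≡⟨ validFrom⇒balanced (suc d) p (trans (sym (validFrom-N∷ d p)) v) ⟩
  countE p           ∎
validFrom⇒balanced (suc d) (E ∷ p) v = cong suc (validFrom⇒balanced d p v)

validFrom-++ : ∀ d e p q r → d + countN p ≡ e + countE p → validFrom d (p ++ q) ≡ true →
  validFrom d (p ++ r) ≡ validFrom e r
validFrom-++ d e []      q r d≡e _ =
  cong (λ t → validFrom t r) (trans (sym (+-identityʳ d)) (trans d≡e (+-identityʳ e)))
validFrom-++ d e (N ∷ p) q r eq v = begin
  validFrom d (N ∷ p ++ r)   ≡⟨ validFrom-N∷ d _ ⟩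
  validFrom (suc d) (p ++ r) ≡⟨ validFrom-++ (suc d) e p q r (trans (sym (+-suc d (countN p))) eq)
                                              (trans (sym (validFrom-N∷ d _)) v) ⟩
  validFrom e r              ∎
validFrom-++ (suc d) e (E ∷ p) q r eq v =
  validFrom-++ d e p q r (suc-injective (trans eq (+-suc e (countE p)))) v

validFrom-EN⇒NE : ∀ d u w → validFrom d (u ++ E ∷ N ∷ w) ≡ true → validFrom d (u ++ N ∷ E ∷ w) ≡ true
validFrom-EN⇒NE (suc d) []      w v = trans (sym (validFrom-N∷ d w)) v
validFrom-EN⇒NE d       (N ∷ u) w v =
  trans (validFrom-N∷ d _) (validFrom-EN⇒NE (suc d) u w (trans (sym (validFrom-N∷ d _)) v))
validFrom-EN⇒NE (suc d) (E ∷ u) w v = validFrom-EN⇒NE d u w v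

isDyck⇒countE : ∀ {n} π → IsDyck n π → countE π ≡ n
isDyck⇒countE π d = trans (sym (validFrom⇒balanced 0 π (isDyck⇒valid π d))) (isDyck⇒countN π d)

isDyck-EN⇒NE : ∀ {n} u w → IsDyck n (u ++ E ∷ N ∷ w) → IsDyck n (u ++ N ∷ E ∷ w)
isDyck-EN⇒NE {n} u w d = isDyck-intro (u ++ N ∷ E ∷ w)
  (trans (countN-++ u (N ∷ E ∷ w)) (trans (sym (countN-++ u (E ∷ N ∷ w)))
    (isDyck⇒countN (u ++ E ∷ N ∷ w) d)))
  (validFrom-EN⇒NE 0 u w (isDyck⇒valid (u ++ E ∷ N ∷ w) d))

-- Step coordinates

xsFrom-++ : ∀ e p q → xsFrom e (p ++ q) ≡ xsFrom e p ++ xsFrom (countE p + e) q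
xsFrom-++ e []      q = refl
xsFrom-++ e (N ∷ p) q = cong (e ∷_) (xsFrom-++ e p q)
xsFrom-++ e (E ∷ p) q =
  trans (xsFrom-++ (suc e) p q) (cong (λ t → xsFrom (suc e) p ++ xsFrom t q) (+-suc (countE p) e))

hsFrom-++ : ∀ k p q → hsFrom k (p ++ q) ≡ hsFrom k p ++ hsFrom (countN p + k) q
hsFrom-++ k []      q = refl
hsFrom-++ k (E ∷ p) q = cong (k ∷_) (hsFrom-++ k p q)
hsFrom-++ k (N ∷ p) q =
  trans (hsFrom-++ (suc k) p q) (cong (λ t → hsFrom (suc k) p ++ hsFrom t q) (+-suc (countN p) k))

length-xsFrom : ∀ e p → length (xsFrom e p) ≡ countN p
length-xsFrom e []      = refl
length-xsFrom e (N ∷ p) = cong suc (length-xsFrom e p)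
length-xsFrom e (E ∷ p) = length-xsFrom (suc e) p

length-hsFrom : ∀ k p → length (hsFrom k p) ≡ countE p
length-hsFrom k []      = refl
length-hsFrom k (E ∷ p) = cong suc (length-hsFrom k p)
length-hsFrom k (N ∷ p) = length-hsFrom (suc k) p

hsFrom-replicateN-++ : ∀ m k q → hsFrom k (replicate m N ++ q) ≡ hsFrom (m + k) q
hsFrom-replicateN-++ zero    k q = refl
hsFrom-replicateN-++ (suc m) k q =
  trans (hsFrom-replicateN-++ m (suc k) q) (cong (λ t → hsFrom t q) (+-suc m k))

hsFrom-replicateE-++ : ∀ m k q → hsFrom k (replicate m E ++ q) ≡ replicate m k ++ hsFrom k q
hsFrom-replicateE-++ zero    k q = refl
hsFrom-replicateE-++ (suc m) k q = cong (k ∷_) (hsFrom-replicateE-++ m k q)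

at-hsFrom-≤ : ∀ k p x → at (hsFrom k p) x ≤ k + countN p
at-hsFrom-≤ k []      x       = z≤n
at-hsFrom-≤ k (N ∷ p) x       =
  subst (at (hsFrom (suc k) p) x ≤_) (sym (+-suc k (countN p))) (at-hsFrom-≤ (suc k) p x)
at-hsFrom-≤ k (E ∷ p) zero    = m≤m+n k _
at-hsFrom-≤ k (E ∷ p) (suc x) = at-hsFrom-≤ k p x

at-hsFrom-> : ∀ d k p x → validFrom d p ≡ true → x < countE p → suc (x + k) ≤ at (hsFrom k p) x + d
at-hsFrom-> d       k (N ∷ p) x       v x<p =
  ≤-pred (subst₂ (λ a b → suc a ≤ b) (+-suc x k) (+-suc _ d)
    (at-hsFrom-> (suc d) (suc k) p x (trans (sym (validFrom-N∷ d p)) v) x<p))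
at-hsFrom-> (suc d) k (E ∷ p) zero    v _         = subst (suc k ≤_) (sym (+-suc k d)) (s≤s (m≤m+n k d))
at-hsFrom-> (suc d) k (E ∷ p) (suc x) v (s≤s x<p) =
  subst (suc (suc x + k) ≤_) (sym (+-suc (at (hsFrom k p) x) d)) (s≤s (at-hsFrom-> d k p x v x<p))

at-hs-++ˡ : ∀ p q {j} → j < countE p → at (hs (p ++ q)) j ≡ at (hs p) j
at-hs-++ˡ p q {j} j<p =
  trans (cong (λ l → at l j) (hsFrom-++ 0 p q))
        (at-++ˡ (hs p) _ (subst (j <_) (sym (length-hsFrom 0 p)) j<p))

at-hs-++ʳ : ∀ p q j → at (hs (p ++ q)) (countE p + j) ≡ at (hsFrom (countN p) q) j
at-hs-++ʳ p q j = begin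
  at (hs (p ++ q)) (countE p + j)           ≡⟨ cong (λ l → at l (countE p + j)) (hsFrom-++ 0 p q) ⟩
  at (hs p ++ H) (countE p + j)             ≡⟨ cong (λ t → at (hs p ++ H) (t + j)) (length-hsFrom 0 p) ⟨
  at (hs p ++ H) (length (hs p) + j)        ≡⟨ at-++ʳ (hs p) H j ⟩
  at (hsFrom (countN p + 0) q) j            ≡⟨ cong (λ t → at (hsFrom t q) j) (+-identityʳ (countN p)) ⟩
  at (hsFrom (countN p) q) j                ∎
  where
  H : List ℕ
  H = hsFrom (countN p + 0) q

hAt-++-≤ : ∀ p q {j} → j ≤ countE p → hAt (p ++ q) j ≤ countN p
hAt-++-≤ p q {zero}  _   = z≤n
hAt-++-≤ p q {suc j} j<p = subst (_≤ countN p) (sym (at-hs-++ˡ p q j<p)) (at-hsFrom-≤ 0 p j)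

fromXFrom-xsFrom : ∀ n e e′ p → e ≤ e′ → e′ + countE p ≡ n →
  fromXFrom n e (xsFrom e′ p) ≡ replicate (e′ ∸ e) E ++ p
fromXFrom-xsFrom n e e′ [] e≤e′ refl = begin
  replicate (e′ + 0 ∸ e) E        ≡⟨ cong (λ t → replicate (t ∸ e) E) (+-identityʳ e′) ⟩
  replicate (e′ ∸ e) E            ≡⟨ ++-identityʳ _ ⟨
  replicate (e′ ∸ e) E ++ []      ∎
fromXFrom-xsFrom n e e′ (N ∷ p) e≤e′ eq =
  cong (λ t → replicate (e′ ∸ e) E ++ N ∷ t)
    (trans (fromXFrom-xsFrom n e′ e′ p ≤-refl eq) (cong (λ t → replicate t E ++ p) (n∸n≡0 e′)))
fromXFrom-xsFrom n e e′ (E ∷ p) e≤e′ eq = begin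
  fromXFrom n e (xsFrom (suc e′) p)
    ≡⟨ fromXFrom-xsFrom n e (suc e′) p (m≤n⇒m≤1+n e≤e′) (trans (sym (+-suc e′ _)) eq) ⟩
  replicate (suc e′ ∸ e) E ++ p    ≡⟨ cong (λ t → replicate t E ++ p) (+-∸-assoc 1 e≤e′) ⟩
  replicate (suc (e′ ∸ e)) E ++ p  ≡⟨ replicate-snoc (e′ ∸ e) E p ⟩
  replicate (e′ ∸ e) E ++ E ∷ p    ∎

fromHFrom-hsFrom : ∀ n k k′ p → k ≤ k′ → k′ + countN p ≡ n →
  fromHFrom n k (hsFrom k′ p) ≡ replicate (k′ ∸ k) N ++ p
fromHFrom-hsFrom n k k′ [] k≤k′ refl = begin
  replicate (k′ + 0 ∸ k) N        ≡⟨ cong (λ t → replicate (t ∸ k) N) (+-identityʳ k′) ⟩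
  replicate (k′ ∸ k) N            ≡⟨ ++-identityʳ _ ⟨
  replicate (k′ ∸ k) N ++ []      ∎
fromHFrom-hsFrom n k k′ (E ∷ p) k≤k′ eq =
  cong (λ t → replicate (k′ ∸ k) N ++ E ∷ t)
    (trans (fromHFrom-hsFrom n k′ k′ p ≤-refl eq) (cong (λ t → replicate t N ++ p) (n∸n≡0 k′)))
fromHFrom-hsFrom n k k′ (N ∷ p) k≤k′ eq = begin
  fromHFrom n k (hsFrom (suc k′) p)
    ≡⟨ fromHFrom-hsFrom n k (suc k′) p (m≤n⇒m≤1+n k≤k′) (trans (sym (+-suc k′ _)) eq) ⟩
  replicate (suc k′ ∸ k) N ++ p    ≡⟨ cong (λ t → replicate t N ++ p) (+-∸-assoc 1 k≤k′) ⟩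
  replicate (suc (k′ ∸ k)) N ++ p  ≡⟨ replicate-snoc (k′ ∸ k) N p ⟩
  replicate (k′ ∸ k) N ++ N ∷ p    ∎

dyckWithX-xs : ∀ {n} π → IsDyck n π → dyckWithX n (xs π) ≡ just π
dyckWithX-xs {n} π d
  rewrite fromXFrom-xsFrom n 0 0 π z≤n (isDyck⇒countE π d)
        | dec-true (≡-dec _≟_ (xs π) (xs π)) refl | d = refl

dyckWithH-hs : ∀ {n} π → IsDyck n π → dyckWithH n (hs π) ≡ just π
dyckWithH-hs {n} π d
  rewrite fromHFrom-hsFrom n 0 0 π z≤n (isDyck⇒countN π d)
        | dec-true (≡-dec _≟_ (hs π) (hs π)) refl | d = refl

-- The operators A⁻¹ and C on adjacent steps

modAt-incr : ∀ (l : List ℕ) {k} x r → length l ≡ k → modAt k incr (l ++ x ∷ r) ≡ just (l ++ suc x ∷ r)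
modAt-incr []      x r refl = refl
modAt-incr (y ∷ l) x r refl = cong (maybeMap (y ∷_)) (modAt-incr l x r refl)

Ainv-swap : ∀ {n j} u w → suc (countN u) ≡ j → IsDyck n (u ++ E ∷ N ∷ w) →
  Ainv n j (u ++ N ∷ E ∷ w) ≡ just (u ++ E ∷ N ∷ w)
Ainv-swap {n} u w refl d = trans (cong (_>>= dyckWithX n) shifted) (dyckWithX-xs (u ++ E ∷ N ∷ w) d)
  where
  shifted : modAt (countN u) incr (xs (u ++ N ∷ E ∷ w)) ≡ just (xs (u ++ E ∷ N ∷ w))
  shifted rewrite xsFrom-++ 0 u (N ∷ E ∷ w) | xsFrom-++ 0 u (E ∷ N ∷ w) =
    modAt-incr (xs u) _ _ (length-xsFrom 0 u)

C-swap : ∀ {n j} u w → suc (countE u) ≡ j → IsDyck n (u ++ N ∷ E ∷ w) →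
  C n j (u ++ E ∷ N ∷ w) ≡ just (u ++ N ∷ E ∷ w)
C-swap {n} u w refl d = trans (cong (_>>= dyckWithH n) raised) (dyckWithH-hs (u ++ N ∷ E ∷ w) d)
  where
  raised : modAt (countE u) incr (hs (u ++ E ∷ N ∷ w)) ≡ just (hs (u ++ N ∷ E ∷ w))
  raised rewrite hsFrom-++ 0 u (N ∷ E ∷ w) | hsFrom-++ 0 u (E ∷ N ∷ w) =
    modAt-incr (hs u) _ _ (length-hsFrom 0 u)

iter-suc : ∀ k (f : Path → Maybe Path) m → iter (suc k) f m ≡ (iter k f m >>= f)
iter-suc zero    f m = refl
iter-suc (suc k) f m = iter-suc k f (m >>= f)

-- Only the lowest path of a slide needs to be Dyck: the others arise from it by EN → NE swaps.
Ainv-slide : ∀ {n j} u t w → suc (countN u) ≡ j → IsDyck n (u ++ replicate t E ++ N ∷ w) →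
  iter t (Ainv n j) (just (u ++ N ∷ replicate t E ++ w)) ≡ just (u ++ replicate t E ++ N ∷ w)
Ainv-slide u zero w row d = refl
Ainv-slide {n} {j} u (suc t) w row d = begin
  iter (suc t) (Ainv n j) (just (u ++ N ∷ replicate (suc t) E ++ w))
    ≡⟨ cong (λ p → iter (suc t) (Ainv n j) (just (u ++ N ∷ p))) (replicate-snoc t E w) ⟩
  iter (suc t) (Ainv n j) (just (u ++ N ∷ replicate t E ++ E ∷ w))
    ≡⟨ iter-suc t (Ainv n j) _ ⟩
  (iter t (Ainv n j) (just (u ++ N ∷ replicate t E ++ E ∷ w)) >>= Ainv n j)
    ≡⟨ cong (_>>= Ainv n j) (Ainv-slide u t (E ∷ w) row d-before) ⟩
  Ainv n j (u ++ replicate t E ++ N ∷ E ∷ w)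
    ≡⟨ cong (Ainv n j) (++-assoc u (replicate t E) _) ⟨
  Ainv n j ((u ++ replicate t E) ++ N ∷ E ∷ w)
    ≡⟨ Ainv-swap (u ++ replicate t E) w row′ d-after ⟩
  just ((u ++ replicate t E) ++ E ∷ N ∷ w)
    ≡⟨ cong just moved ⟩
  just (u ++ replicate (suc t) E ++ N ∷ w) ∎
  where
  moved : (u ++ replicate t E) ++ E ∷ N ∷ w ≡ u ++ replicate (suc t) E ++ N ∷ w
  moved = trans (++-assoc u _ _) (cong (u ++_) (sym (replicate-snoc t E (N ∷ w))))
  d-after : IsDyck n ((u ++ replicate t E) ++ E ∷ N ∷ w)
  d-after = subst (IsDyck n) (sym moved) d
  d-before : IsDyck n (u ++ replicate t E ++ N ∷ E ∷ w)
  d-before = subst (IsDyck n) (++-assoc u _ _) (isDyck-EN⇒NE (u ++ replicate t E) w d-after)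
  row′ : suc (countN (u ++ replicate t E)) ≡ j
  row′ = trans (cong suc (trans (countN-++ u _) (trans (cong (countN u +_) (countN-replicateE t))
                                                         (+-identityʳ _)))) row

C-slide : ∀ {n j} u t w → suc (countE u) ≡ j → IsDyck n (u ++ E ∷ replicate t N ++ w) →
  iter t (C n j) (just (u ++ E ∷ replicate t N ++ w)) ≡ just (u ++ replicate t N ++ E ∷ w)
C-slide u zero w column d = refl
C-slide {n} {j} u (suc t) w column d = begin
  iter t (C n j) (C n j (u ++ E ∷ N ∷ replicate t N ++ w))
    ≡⟨ cong (iter t (C n j)) (C-swap u _ column d-next) ⟩
  iter t (C n j) (just (u ++ N ∷ E ∷ replicate t N ++ w))
    ≡⟨ cong (λ p → iter t (C n j) (just p)) (++-assoc u [ N ] _) ⟨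
  iter t (C n j) (just ((u ++ [ N ]) ++ E ∷ replicate t N ++ w))
    ≡⟨ C-slide (u ++ [ N ]) t w column′ (subst (IsDyck n) (sym (++-assoc u [ N ] _)) d-next) ⟩
  just ((u ++ [ N ]) ++ replicate t N ++ E ∷ w)
    ≡⟨ cong just (++-assoc u [ N ] _) ⟩
  just (u ++ replicate (suc t) N ++ E ∷ w) ∎
  where
  d-next : IsDyck n (u ++ N ∷ E ∷ replicate t N ++ w)
  d-next = isDyck-EN⇒NE u _ d
  column′ : suc (countE (u ++ [ N ])) ≡ j
  column′ = trans (cong suc (trans (countE-++ u [ N ]) (+-identityʳ _))) column

Ainv-slide-last : ∀ {n j} u m t w → suc (countN u + m) ≡ j →
  IsDyck n (u ++ replicate m N ++ replicate t E ++ N ∷ w) →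
  iter t (Ainv n j) (just (u ++ replicate (suc m) N ++ replicate t E ++ w)) ≡
    just (u ++ replicate m N ++ replicate t E ++ N ∷ w)
Ainv-slide-last {n} {j} u m t w row d = begin
  iter t (Ainv n j) (just (u ++ replicate (suc m) N ++ replicate t E ++ w))
    ≡⟨ cong (λ p → iter t (Ainv n j) (just p)) split ⟩
  iter t (Ainv n j) (just ((u ++ replicate m N) ++ N ∷ replicate t E ++ w))
    ≡⟨ Ainv-slide (u ++ replicate m N) t w row′ (subst (IsDyck n) (sym (++-assoc u _ _)) d) ⟩
  just ((u ++ replicate m N) ++ replicate t E ++ N ∷ w)
    ≡⟨ cong just (++-assoc u _ _) ⟩
  just (u ++ replicate m N ++ replicate t E ++ N ∷ w) ∎
  where
  split : u ++ replicate (suc m) N ++ replicate t E ++ w ≡ (u ++ replicate m N) ++ N ∷ replicate t E ++ w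
  split = trans (cong (u ++_) (replicate-snoc m N _)) (sym (++-assoc u _ _))
  row′ : suc (countN (u ++ replicate m N)) ≡ j
  row′ = trans (cong suc (trans (countN-++ u _) (cong (countN u +_) (countN-replicateN m)))) row

C-slide-last : ∀ {n j} u m t w → suc (countE u + m) ≡ j →
  IsDyck n (u ++ replicate (suc m) E ++ replicate t N ++ w) →
  iter t (C n j) (just (u ++ replicate (suc m) E ++ replicate t N ++ w)) ≡
    just (u ++ replicate m E ++ replicate t N ++ E ∷ w)
C-slide-last {n} {j} u m t w column d = begin
  iter t (C n j) (just (u ++ replicate (suc m) E ++ replicate t N ++ w))
    ≡⟨ cong (λ p → iter t (C n j) (just p)) split ⟩
  iter t (C n j) (just ((u ++ replicate m E) ++ E ∷ replicate t N ++ w))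
    ≡⟨ C-slide (u ++ replicate m E) t w column′ (subst (IsDyck n) split d) ⟩
  just ((u ++ replicate m E) ++ replicate t N ++ E ∷ w)
    ≡⟨ cong just (++-assoc u _ _) ⟩
  just (u ++ replicate m E ++ replicate t N ++ E ∷ w) ∎
  where
  split : u ++ replicate (suc m) E ++ replicate t N ++ w ≡ (u ++ replicate m E) ++ E ∷ replicate t N ++ w
  split = trans (cong (u ++_) (replicate-snoc m E _)) (sym (++-assoc u _ _))
  column′ : suc (countE (u ++ replicate m E)) ≡ j
  column′ = trans (cong suc (trans (countE-++ u _) (cong (countE u +_) (countE-replicateE m)))) column

-- Bounce points

module _ {n : ℕ} (Q : Path) (dQ : IsDyck n Q) where

  hAt≤n : ∀ y → hAt Q y ≤ n
  hAt≤n zero    = z≤n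
  hAt≤n (suc y) = subst (at (hs Q) y ≤_) (isDyck⇒countN Q dQ) (at-hsFrom-≤ 0 Q y)

  <hAt-suc : ∀ {x} → x < n → x < hAt Q (suc x)
  <hAt-suc {x} x<n = subst₂ (λ a b → suc a ≤ b) (+-identityʳ x) (+-identityʳ _)
    (at-hsFrom-> 0 0 Q x (isDyck⇒valid Q dQ) (subst (x <_) (sym (isDyck⇒countE Q dQ)) x<n))

  bounce-step-< : ∀ {b} → b ≤ n → (b ≡ᵇ n) ≡ false → b < hAt Q (suc b)
  bounce-step-< b≤n b≢n = <hAt-suc (≤∧≢⇒< b≤n (≡ᵇ-false⇒≢ b≢n))

  bounceFrom-< : ∀ fu {b} j → b ≤ n → j < length (bounceFrom fu n Q b) → b < at (bounceFrom fu n Q b) j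
  bounceFrom-< (suc fu) {b} j b≤n j<len with b ≡ᵇ n in b≢n
  bounceFrom-< (suc fu) {b} zero    b≤n _           | false = bounce-step-< b≤n b≢n
  bounceFrom-< (suc fu) {b} (suc j) b≤n (s≤s j<len) | false =
    <-trans (bounce-step-< b≤n b≢n) (bounceFrom-< fu j (hAt≤n (suc b)) j<len)

  bounceChain-strict : ∀ fu {b} j → b ≤ n → suc j < length (b ∷ bounceFrom fu n Q b) →
    at (b ∷ bounceFrom fu n Q b) j < at (b ∷ bounceFrom fu n Q b) (suc j)
  bounceChain-strict fu       zero    b≤n (s≤s len) = bounceFrom-< fu 0 b≤n len
  bounceChain-strict zero     (suc j) b≤n (s≤s ())
  bounceChain-strict (suc fu) {b} (suc j) b≤n len with b ≡ᵇ n in b≢n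
  bounceChain-strict (suc fu) {b} (suc j) b≤n (s≤s len) | false = bounceChain-strict fu j (hAt≤n (suc b)) len

  bounceChain-≥ : ∀ fu {b} j → b ≤ n → j < length (b ∷ bounceFrom fu n Q b) →
    b ≤ at (b ∷ bounceFrom fu n Q b) j
  bounceChain-≥ fu zero    b≤n _         = ≤-refl
  bounceChain-≥ fu (suc j) b≤n (s≤s len) = <⇒≤ (bounceFrom-< fu j b≤n len)

  bounceFrom-cong : ∀ {P} fu {b t} → t ≤ b → b ≤ n →
    (∀ x → t ≤ x → hAt P (suc x) ≡ hAt Q (suc x)) →
    bounceFrom fu n P b ≡ bounceFrom fu n Q b
  bounceFrom-cong zero     t≤b b≤n agree = refl
  bounceFrom-cong (suc fu) {b} t≤b b≤n agree with b ≡ᵇ n in b≢n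
  ... | true  = refl
  ... | false rewrite agree b t≤b =
    cong (hAt Q (suc b) ∷_)
      (bounceFrom-cong fu (≤-trans t≤b (<⇒≤ (bounce-step-< b≤n b≢n))) (hAt≤n (suc b)) agree)

bounceChain-next : ∀ {n Q} fu {b} j → suc j < length (b ∷ bounceFrom fu n Q b) →
  at (b ∷ bounceFrom fu n Q b) (suc j) ≡ hAt Q (suc (at (b ∷ bounceFrom fu n Q b) j))
bounceChain-next zero j (s≤s ())
bounceChain-next {n} (suc fu) {b} j len with b ≡ᵇ n
bounceChain-next {n} (suc fu) {b} j       (s≤s ())  | true
bounceChain-next {n} (suc fu) {b} zero    _         | false = refl
bounceChain-next {n} (suc fu) {b} (suc j) (s≤s len) | false = bounceChain-next fu j len

module _ {n : ℕ} (Q : Path) {P : Path} (dQ : IsDyck n Q) {β v : ℕ}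
  (agree-below : ∀ x → x < β → hAt P (suc x) ≡ hAt Q (suc x))
  (P-after-β : hAt P (suc β) ≡ v)
  (P-after-v : hAt P (suc v) ≡ hAt Q (suc (hAt Q (suc β))))
  (agree-above : ∀ x → hAt Q (suc (hAt Q (suc β))) ≤ x → hAt P (suc x) ≡ hAt Q (suc x))
  (v≢n : v ≢ n) where

  private
    bounceFrom-v : ∀ fu → 0 < length (bounceFrom fu n Q (hAt Q (suc β))) →
      bounceFrom fu n P v ≡ bounceFrom fu n Q (hAt Q (suc β))
    bounceFrom-v (suc fu) len with hAt Q (suc β) ≡ᵇ n
    ... | false rewrite ≢⇒≡ᵇ-false v≢n | P-after-v =
      cong (_ ∷_) (bounceFrom-cong Q dQ fu ≤-refl (hAt≤n Q dQ (suc (hAt Q (suc β)))) agree-above)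

  bounceFrom-setAt : ∀ fu {b} j → b ≤ n → at (b ∷ bounceFrom fu n Q b) j ≡ β →
    suc (suc j) < length (b ∷ bounceFrom fu n Q b) → bounceFrom fu n P b ≡ setAt j v (bounceFrom fu n Q b)
  bounceFrom-setAt zero     j b≤n b≡β (s≤s ())
  bounceFrom-setAt (suc fu) {b} j b≤n b≡β len with b ≡ᵇ n in b≢n
  bounceFrom-setAt (suc fu) {b} zero b≤n refl (s≤s (s≤s len)) | false
    rewrite P-after-β = cong (v ∷_) (bounceFrom-v fu len)
  bounceFrom-setAt (suc fu) {b} (suc j) b≤n b≡β (s≤s len) | false =
    trans (cong (λ h → h ∷ bounceFrom fu n P h) (agree-below b b<β))
          (cong (hAt Q (suc b) ∷_) (bounceFrom-setAt fu j (hAt≤n Q dQ (suc b)) b≡β len))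
    where
    b<β : b < β
    b<β = <-≤-trans (bounce-step-< Q dQ b≤n b≢n) (subst (hAt Q (suc b) ≤_) b≡β
            (bounceChain-≥ Q dQ fu j (hAt≤n Q dQ (suc b))
              (<-trans (<-trans (n<1+n j) (n<1+n (suc j))) len)))

  bouncePoints-setAt : ∀ j → at (bouncePoints n Q) j ≡ β → suc (suc j) < length (bouncePoints n Q) →
    bouncePoints n P ≡ setAt (suc j) v (bouncePoints n Q)
  bouncePoints-setAt j b≡β len = cong (0 ∷_) (bounceFrom-setAt n j z≤n b≡β len)

S-unfold : ∀ {n i π bs} → bouncePoints n π ≡ bs → suc (suc i) < length bs →
  hAt π (at bs i) ≢ at bs (suc i) →
  S n (suc i) π ≡ iter (at bs (suc (suc i)) ∸ hAt π (at bs (suc i))) (C n (at bs (suc i)))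
                    (iter (at bs (suc (suc i)) ∸ hAt π (at bs (suc i))) (Ainv n (at bs (suc i))) (just π))
S-unfold refl len h≢b
  rewrite ≢⇒≡ᵇ-false (m>n⇒m∸n≢0 (∸-monoˡ-< len (s≤s z≤n))) | ≢⇒≡ᵇ-false h≢b = refl

-- The paths P r k

module Interpolation (pre post : Path) (c : ℕ) where

  middle : ℕ → ℕ → ℕ → ℕ → Path
  middle x y z w =
    replicate x N ++ replicate c E ++ replicate y N ++ replicate z E ++ replicate c N ++ replicate w E ++ post

  P : ℕ → ℕ → Path
  P r k = pre ++ middle r k r k

  κ β : ℕ
  κ = countN pre
  β = countE pre

  P-δ-0 : ∀ δ a → a ≡ c + δ → pre ++ replicate δ N ++ replicate a E ++ replicate c N ++ post ≡ P δ 0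
  P-δ-0 δ a refl = cong (λ t → pre ++ replicate δ N ++ t) (replicate-+-++ c δ E _)

  P-0-δ : ∀ δ a → a ≡ δ + c → pre ++ replicate c E ++ replicate a N ++ replicate δ E ++ post ≡ P 0 δ
  P-0-δ δ a refl = cong (λ t → pre ++ replicate c E ++ t) (replicate-+-++ δ c N _)

  countN-middle : ∀ x y z w → countN (middle x y z w) ≡ x + (y + (c + countN post))
  countN-middle x y z w =
    trans (countN-replicateN-++ x _) (cong (x +_)
    (trans (countN-replicateE-++ c _) (trans (countN-replicateN-++ y _) (cong (y +_)
    (trans (countN-replicateE-++ z _) (trans (countN-replicateN-++ c _) (cong (c +_)
    (countN-replicateE-++ w post))))))))

  validFrom-middle : ∀ x y z w → x + y ≡ z + w → validFrom c (middle x y z w) ≡ validFrom c post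
  validFrom-middle x y z w balanced = begin
    validFrom c (replicate x N ++ R₁)  ≡⟨ validFrom-replicateN-++ x c R₁ ⟩
    validFrom (x + c) R₁               ≡⟨ cong (λ e → validFrom e R₁) (+-comm x c) ⟩
    validFrom (c + x) R₁               ≡⟨ validFrom-replicateE-++ c x R₂ ⟩
    validFrom x (replicate y N ++ R₃)  ≡⟨ validFrom-replicateN-++ y x R₃ ⟩
    validFrom (y + x) R₃               ≡⟨ cong (λ e → validFrom e R₃) (trans (+-comm y x) balanced) ⟩
    validFrom (z + w) R₃               ≡⟨ validFrom-replicateE-++ z w R₄ ⟩
    validFrom w (replicate c N ++ R₅)  ≡⟨ validFrom-replicateN-++ c w R₅ ⟩
    validFrom (c + w) R₅               ≡⟨ cong (λ e → validFrom e R₅) (+-comm c w) ⟩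
    validFrom (w + c) R₅               ≡⟨ validFrom-replicateE-++ w c post ⟩
    validFrom c post                   ∎
    where
    R₁ R₂ R₃ R₄ R₅ : Path
    R₅ = replicate w E ++ post
    R₄ = replicate c N ++ R₅
    R₃ = replicate z E ++ R₄
    R₂ = replicate y N ++ R₃
    R₁ = replicate c E ++ R₂

  isDyck-middle : ∀ {n δ} → κ ≡ c + β → IsDyck n (P δ 0) →
    ∀ x y z w → x + y ≡ δ → z + w ≡ δ → IsDyck n (pre ++ middle x y z w)
  isDyck-middle {n} {δ} excess d x y z w x+y≡δ z+w≡δ =
    isDyck-intro (pre ++ middle x y z w) same-count valid
    where
    same-count : countN (pre ++ middle x y z w) ≡ n
    same-count = begin
      countN (pre ++ middle x y z w)      ≡⟨ countN-++ pre _ ⟩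
      κ + countN (middle x y z w)         ≡⟨ cong (κ +_) (countN-middle x y z w) ⟩
      κ + (x + (y + (c + countN post)))   ≡⟨ cong (κ +_) (+-assoc x y _) ⟨
      κ + (x + y + (c + countN post))     ≡⟨ cong (λ t → κ + (t + (c + countN post))) x+y≡δ ⟩
      κ + (δ + (0 + (c + countN post)))   ≡⟨ cong (κ +_) (countN-middle δ 0 δ 0) ⟨
      κ + countN (middle δ 0 δ 0)         ≡⟨ countN-++ pre _ ⟨
      countN (P δ 0)                      ≡⟨ isDyck⇒countN (P δ 0) d ⟩
      n                                   ∎
    valid : validFrom 0 (pre ++ middle x y z w) ≡ true
    after-pre : ∀ q → validFrom 0 (pre ++ q) ≡ validFrom c q
    after-pre q = validFrom-++ 0 c pre (middle δ 0 δ 0) q excess (isDyck⇒valid (P δ 0) d)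
    valid = begin
      validFrom 0 (pre ++ middle x y z w) ≡⟨ after-pre (middle x y z w) ⟩
      validFrom c (middle x y z w)        ≡⟨ validFrom-middle x y z w (trans x+y≡δ (sym z+w≡δ)) ⟩
      validFrom c post                    ≡⟨ validFrom-middle δ 0 δ 0 refl ⟨
      validFrom c (middle δ 0 δ 0)        ≡⟨ after-pre (middle δ 0 δ 0) ⟨
      validFrom 0 (P δ 0)                 ≡⟨ isDyck⇒valid (P δ 0) d ⟩
      true                                ∎

  hsFrom-middle : ∀ x y z w k → hsFrom k (middle x y z w) ≡
    replicate c (x + k) ++ replicate z (y + (x + k)) ++ replicate w (c + (y + (x + k))) ++
      hsFrom (c + (y + (x + k))) post
  hsFrom-middle x y z w k =
    trans (hsFrom-replicateN-++ x k _) (trans (hsFrom-replicateE-++ c (x + k) _) (cong (replicate c (x + k) ++_)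
    (trans (hsFrom-replicateN-++ y (x + k) _) (trans (hsFrom-replicateE-++ z (y + (x + k)) _)
    (cong (replicate z (y + (x + k)) ++_)
    (trans (hsFrom-replicateN-++ c (y + (x + k)) _) (hsFrom-replicateE-++ w (c + (y + (x + k))) post)))))))

  module _ (x y z w k : ℕ) where
    private
      k₁ k₂ k₃ : ℕ
      k₁ = x + k
      k₂ = y + k₁
      k₃ = c + k₂
      Hw Hz : List ℕ
      Hw = replicate w k₃ ++ hsFrom k₃ post
      Hz = replicate z k₂ ++ Hw

    at-hsFrom-middle-c : ∀ {j} → j < c → at (hsFrom k (middle x y z w)) j ≡ x + k
    at-hsFrom-middle-c {j} j<c =
      trans (cong (λ l → at l j) (hsFrom-middle x y z w k)) (at-replicate-++ˡ c k₁ Hz j<c)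

    at-hsFrom-middle-z : ∀ {j} → j < z → at (hsFrom k (middle x y z w)) (c + j) ≡ y + (x + k)
    at-hsFrom-middle-z {j} j<z = begin
      at (hsFrom k (middle x y z w)) (c + j)  ≡⟨ cong (λ l → at l (c + j)) (hsFrom-middle x y z w k) ⟩
      at (replicate c k₁ ++ Hz) (c + j)       ≡⟨ at-replicate-++ʳ c k₁ Hz j ⟩
      at (replicate z k₂ ++ Hw) j             ≡⟨ at-replicate-++ˡ z k₂ Hw j<z ⟩
      k₂                                      ∎

    at-hsFrom-middle-w : ∀ {j} → j < w → at (hsFrom k (middle x y z w)) (c + (z + j)) ≡ c + (y + (x + k))
    at-hsFrom-middle-w {j} j<w = begin
      at (hsFrom k (middle x y z w)) (c + (z + j))  ≡⟨ cong (λ l → at l (c + (z + j))) (hsFrom-middle x y z w k) ⟩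
      at (replicate c k₁ ++ Hz) (c + (z + j))       ≡⟨ at-replicate-++ʳ c k₁ Hz (z + j) ⟩
      at (replicate z k₂ ++ Hw) (z + j)             ≡⟨ at-replicate-++ʳ z k₂ Hw j ⟩
      at Hw j                                       ≡⟨ at-replicate-++ˡ w k₃ _ j<w ⟩
      k₃                                            ∎

    at-hsFrom-middle-post : ∀ j →
      at (hsFrom k (middle x y z w)) (c + (z + (w + j))) ≡ at (hsFrom (c + (y + (x + k))) post) j
    at-hsFrom-middle-post j = begin
      at (hsFrom k (middle x y z w)) (c + (z + (w + j)))
        ≡⟨ cong (λ l → at l (c + (z + (w + j)))) (hsFrom-middle x y z w k) ⟩
      at (replicate c k₁ ++ Hz) (c + (z + (w + j)))       ≡⟨ at-replicate-++ʳ c k₁ Hz (z + (w + j)) ⟩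
      at (replicate z k₂ ++ Hw) (z + (w + j))             ≡⟨ at-replicate-++ʳ z k₂ Hw (w + j) ⟩
      at Hw (w + j)                                       ≡⟨ at-replicate-++ʳ w k₃ _ j ⟩
      at (hsFrom k₃ post) j                               ∎

  hAt-P-below : ∀ r k r′ k′ {x} → x < β → hAt (P r k) (suc x) ≡ hAt (P r′ k′) (suc x)
  hAt-P-below r k r′ k′ x<β =
    trans (at-hs-++ˡ pre (middle r k r k) x<β) (sym (at-hs-++ˡ pre (middle r′ k′ r′ k′) x<β))

  hAt-P-β : ∀ r k → 0 < c → hAt (P r k) (suc β) ≡ r + κ
  hAt-P-β r k c>0 = begin
    at (hs (P r k)) β                   ≡⟨ cong (at (hs (P r k))) (+-identityʳ β) ⟨
    at (hs (P r k)) (β + 0)             ≡⟨ at-hs-++ʳ pre (middle r k r k) 0 ⟩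
    at (hsFrom κ (middle r k r k)) 0    ≡⟨ at-hsFrom-middle-c r k r k κ c>0 ⟩
    r + κ                               ∎

  hAt-P-post : ∀ r k {x} → β + (c + (r + k)) ≤ x →
    hAt (P r k) (suc x) ≡ at (hsFrom (c + (r + k + κ)) post) (x ∸ (β + (c + (r + k))))
  hAt-P-post r k {x} end≤x = begin
    at (hs (P r k)) x                                   ≡⟨ cong (at (hs (P r k))) x≡ ⟩
    at (hs (P r k)) (β + (c + (r + (k + j))))           ≡⟨ at-hs-++ʳ pre (middle r k r k) _ ⟩
    at (hsFrom κ (middle r k r k)) (c + (r + (k + j)))  ≡⟨ at-hsFrom-middle-post r k r k κ j ⟩
    at (hsFrom (c + (k + (r + κ))) post) j
      ≡⟨ cong (λ t → at (hsFrom (c + t) post) j) (reassoc′ k r κ) ⟩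
    at (hsFrom (c + (r + k + κ)) post) j                ∎
    where
    j : ℕ
    j = x ∸ (β + (c + (r + k)))
    reassoc : ∀ β c r k j → β + (c + (r + k)) + j ≡ β + (c + (r + (k + j)))
    reassoc = solve-∀
    reassoc′ : ∀ k r κ → k + (r + κ) ≡ r + k + κ
    reassoc′ = solve-∀
    x≡ : x ≡ β + (c + (r + (k + j)))
    x≡ = trans (sym (m+[n∸m]≡n end≤x)) (reassoc β c r k j)

  hAt-P-above : ∀ r k r′ k′ → r + k ≡ r′ + k′ → ∀ x → β + (c + (r + k)) ≤ x →
    hAt (P r k) (suc x) ≡ hAt (P r′ k′) (suc x)
  hAt-P-above r k r′ k′ same x end≤x = begin
    hAt (P r k) (suc x)                                            ≡⟨ hAt-P-post r k end≤x ⟩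
    at (hsFrom (c + (r + k + κ)) post) (x ∸ (β + (c + (r + k))))
      ≡⟨ cong (λ d → at (hsFrom (c + (d + κ)) post) (x ∸ (β + (c + d)))) same ⟩
    at (hsFrom (c + (r′ + k′ + κ)) post) (x ∸ (β + (c + (r′ + k′))))
      ≡⟨ hAt-P-post r′ k′ (subst (λ d → β + (c + d) ≤ x) same end≤x) ⟨
    hAt (P r′ k′) (suc x)                                          ∎

  module Swapping {n δ i : ℕ} (dQ : IsDyck n (P δ 0)) (excess : κ ≡ c + β)
    (len : suc (suc i) < length (bouncePoints n (P δ 0)))
    (β≡ : β ≡ at (bouncePoints n (P δ 0)) i)
    (c≡ : c ≡ at (bouncePoints n (P δ 0)) (suc (suc i)) ∸ at (bouncePoints n (P δ 0)) (suc i)) where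

    private
      Q : Path
      Q = P δ 0
      bs : List ℕ
      bs = bouncePoints n Q

    b₁≡hQ : at bs (suc i) ≡ hAt Q (suc β)
    b₁≡hQ = trans (bounceChain-next n i (<-trans (n<1+n _) len)) (cong (λ b → hAt Q (suc b)) (sym β≡))

    b₂≡hQ : at bs (suc (suc i)) ≡ hAt Q (suc (hAt Q (suc β)))
    b₂≡hQ = trans (bounceChain-next n (suc i) len) (cong (λ b → hAt Q (suc b)) b₁≡hQ)

    b₁<b₂ : at bs (suc i) < at bs (suc (suc i))
    b₁<b₂ = bounceChain-strict Q dQ n (suc i) z≤n len

    c>0 : 0 < c
    c>0 = subst (0 <_) (sym c≡) (m<n⇒0<n∸m b₁<b₂)

    b₁≡ : at bs (suc i) ≡ δ + κ
    b₁≡ = trans b₁≡hQ (hAt-P-β δ 0 c>0)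

    b₂≡ : at bs (suc (suc i)) ≡ c + (δ + κ)
    b₂≡ = begin
      at bs (suc (suc i))                                    ≡⟨ m+[n∸m]≡n (<⇒≤ b₁<b₂) ⟨
      at bs (suc i) + (at bs (suc (suc i)) ∸ at bs (suc i))  ≡⟨ cong₂ _+_ b₁≡ (sym c≡) ⟩
      δ + κ + c                                              ≡⟨ +-comm (δ + κ) c ⟩
      c + (δ + κ)                                            ∎

    middle-end≤b₂ : β + (c + δ) ≤ c + (δ + κ)
    middle-end≤b₂ =
      subst (β + (c + δ) ≤_) (trans (reassoc β c δ) (cong (λ t → c + (δ + t)) (sym excess))) (m≤m+n _ c)
      where
      reassoc : ∀ β c δ → β + (c + δ) + c ≡ c + (δ + (c + β))
      reassoc = solve-∀

    b₂≤n : c + (δ + κ) ≤ n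
    b₂≤n = subst (_≤ n) (trans (sym b₂≡hQ) b₂≡) (hAt≤n Q dQ _)

    hAt-P-suc-b₁ : ∀ {r k} → r + k ≡ δ → hAt (P r k) (suc (r + κ)) ≡ c + (δ + κ)
    hAt-P-suc-b₁ {r} {zero} r+0≡δ =
      subst (λ t → hAt (P t 0) (suc (t + κ)) ≡ c + (δ + κ)) (sym r≡δ) b₂-in-Q
      where
      r≡δ : r ≡ δ
      r≡δ = trans (sym (+-identityʳ r)) r+0≡δ
      b₂-in-Q : hAt Q (suc (δ + κ)) ≡ c + (δ + κ)
      b₂-in-Q = trans (cong (λ b → hAt Q (suc b)) (sym b₁≡))
                      (trans (sym (bounceChain-next n (suc i) len)) b₂≡)
    hAt-P-suc-b₁ {r} {suc k} r+k≡δ = begin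
      at (hs (P r (suc k))) (r + κ)                             ≡⟨ cong (at (hs (P r (suc k)))) index ⟩
      at (hs (P r (suc k))) (β + (c + (r + 0)))
        ≡⟨ at-hs-++ʳ pre (middle r (suc k) r (suc k)) _ ⟩
      at (hsFrom κ (middle r (suc k) r (suc k))) (c + (r + 0))
        ≡⟨ at-hsFrom-middle-w r (suc k) r (suc k) κ (s≤s z≤n) ⟩
      c + (suc k + (r + κ))                                     ≡⟨ cong (c +_) height ⟩
      c + (δ + κ)                                               ∎
      where
      index : r + κ ≡ β + (c + (r + 0))
      index = trans (cong (r +_) excess) (reassoc r c β)
        where
        reassoc : ∀ r c β → r + (c + β) ≡ β + (c + (r + 0))
        reassoc = solve-∀
      height : suc k + (r + κ) ≡ δ + κ
      height = trans (sym (+-assoc (suc k) r κ)) (cong (_+ κ) (trans (+-comm (suc k) r) r+k≡δ))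

    bouncePoints-P : ∀ {r k} → r + k ≡ δ → bouncePoints n (P r k) ≡ setAt (suc i) (r + κ) bs
    bouncePoints-P {r} {k} r+k≡δ =
      bouncePoints-setAt Q dQ (λ x → hAt-P-below r k δ 0) (hAt-P-β r k c>0) after above r+κ≢n
        i (sym β≡) len
      where
      after : hAt (P r k) (suc (r + κ)) ≡ hAt Q (suc (hAt Q (suc β)))
      after = trans (hAt-P-suc-b₁ r+k≡δ) (trans (sym b₂≡) b₂≡hQ)
      above : ∀ x → hAt Q (suc (hAt Q (suc β))) ≤ x → hAt (P r k) (suc x) ≡ hAt Q (suc x)
      above x b₂≤x = hAt-P-above r k δ 0 (trans r+k≡δ (sym (+-identityʳ δ))) x
        (subst (λ d → β + (c + d) ≤ x) (sym r+k≡δ)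
          (≤-trans middle-end≤b₂ (subst (_≤ x) (trans (sym b₂≡hQ) b₂≡) b₂≤x)))
      r+κ≢n : r + κ ≢ n
      r+κ≢n = <⇒≢ (≤-<-trans (+-monoˡ-≤ κ (subst (r ≤_) r+k≡δ (m≤m+n r k)))
                             (<-≤-trans (m<n+m (δ + κ) c>0) b₂≤n))

    hAt-P-b₁ : ∀ {r k} → suc r + k ≡ δ → hAt (P (suc r) k) (suc r + κ) ≡ δ + κ
    hAt-P-b₁ {r} {k} eq = begin
      at (hs (P (suc r) k)) (r + κ)                       ≡⟨ cong (at (hs (P (suc r) k))) index ⟩
      at (hs (P (suc r) k)) (β + (c + r))                 ≡⟨ at-hs-++ʳ pre (middle (suc r) k (suc r) k) _ ⟩
      at (hsFrom κ (middle (suc r) k (suc r) k)) (c + r)  ≡⟨ at-hsFrom-middle-z (suc r) k (suc r) k κ (n<1+n r) ⟩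
      k + (suc r + κ)                                     ≡⟨ +-assoc k (suc r) κ ⟨
      k + suc r + κ                                       ≡⟨ cong (_+ κ) (trans (+-comm k (suc r)) eq) ⟩
      δ + κ                                               ∎
      where
      index : r + κ ≡ β + (c + r)
      index = trans (cong (r +_) excess) (reassoc r c β)
        where
        reassoc : ∀ r c β → r + (c + β) ≡ β + (c + r)
        reassoc = solve-∀

    S-P-unfold : ∀ {r k} → suc r + k ≡ δ →
      S n (suc i) (P (suc r) k) ≡
        iter c (C n (suc r + κ)) (iter c (Ainv n (suc r + κ)) (just (P (suc r) k)))
    S-P-unfold {r} {k} eq = begin
      S n (suc i) (P (suc r) k)
        ≡⟨ S-unfold (bouncePoints-P eq) (subst (suc (suc i) <_) (sym (length-setAt (suc i) b bs)) len)
                    h≢b ⟩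
      iter s (C n (at bs′ (suc i))) (iter s (Ainv n (at bs′ (suc i))) (just (P (suc r) k)))
        ≡⟨ cong₂ (λ s b → iter s (C n b) (iter s (Ainv n b) (just (P (suc r) k)))) s≡c b′≡b ⟩
      iter c (C n b) (iter c (Ainv n b) (just (P (suc r) k)))
        ∎
      where
      b s : ℕ
      bs′ : List ℕ
      b = suc r + κ
      bs′ = setAt (suc i) b bs
      s = at bs′ (suc (suc i)) ∸ hAt (P (suc r) k) (at bs′ (suc i))
      b′≡b : at bs′ (suc i) ≡ b
      b′≡b = at-setAt-≡ (suc i) b bs (<-trans (n<1+n _) len)
      s≡c : s ≡ c
      s≡c = begin
        at bs′ (suc (suc i)) ∸ hAt (P (suc r) k) (at bs′ (suc i))
          ≡⟨ cong₂ _∸_ (at-setAt-≢ (suc i) b bs (<⇒≢ (n<1+n _) ∘ sym))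
                       (cong (hAt (P (suc r) k)) b′≡b) ⟩
        at bs (suc (suc i)) ∸ hAt (P (suc r) k) b   ≡⟨ cong₂ _∸_ b₂≡ (hAt-P-b₁ eq) ⟩
        c + (δ + κ) ∸ (δ + κ)                       ≡⟨ m+n∸n≡m c (δ + κ) ⟩
        c                                           ∎
      h≢b : hAt (P (suc r) k) (at bs′ i) ≢ at bs′ (suc i)
      h≢b h≡b = ≤⇒≯ (subst (_≤ κ) (trans h≡b b′≡b) h≤κ) (s≤s (m≤n+m κ r))
        where
        h≤κ : hAt (P (suc r) k) (at bs′ i) ≤ κ
        h≤κ = subst (λ t → hAt (P (suc r) k) t ≤ κ)
                (trans β≡ (sym (at-setAt-≢ (suc i) b bs (<⇒≢ (n<1+n i)))))
                (hAt-++-≤ pre (middle (suc r) k (suc r) k) ≤-refl)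

    slide-both : ∀ {r k} → suc r + k ≡ δ →
      iter c (C n (suc r + κ)) (iter c (Ainv n (suc r + κ)) (just (P (suc r) k))) ≡ just (P r (suc k))
    slide-both {r} {k} eq = begin
      iter c (C n b) (iter c (Ainv n b) (just (P (suc r) k)))
        ≡⟨ cong (iter c (C n b)) (Ainv-slide-last pre r c _ (cong suc (+-comm κ r)) between) ⟩
      iter c (C n b) (just (pre ++ middle r (suc k) (suc r) k))
        ≡⟨ cong (λ p → iter c (C n b) (just p)) regroup ⟨
      iter c (C n b) (just (u ++ replicate (suc r) E ++ replicate c N ++ replicate k E ++ post))
        ≡⟨ C-slide-last u r c (replicate k E ++ post) column (subst (IsDyck n) (sym regroup) between) ⟩
      just (u ++ replicate r E ++ replicate c N ++ E ∷ replicate k E ++ post)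
        ≡⟨ cong just (++-assoc₄ pre (replicate r N) (replicate c E) (replicate (suc k) N) _) ⟩
      just (P r (suc k)) ∎
      where
      b : ℕ
      b = suc r + κ
      u : Path
      u = pre ++ replicate r N ++ replicate c E ++ replicate (suc k) N
      regroup : u ++ replicate (suc r) E ++ replicate c N ++ replicate k E ++ post ≡
                pre ++ middle r (suc k) (suc r) k
      regroup = ++-assoc₄ pre (replicate r N) (replicate c E) (replicate (suc k) N) _
      between : IsDyck n (pre ++ middle r (suc k) (suc r) k)
      between = isDyck-middle excess dQ r (suc k) (suc r) k (trans (+-suc r k) eq) eq
      column : suc (countE u + r) ≡ b
      column = cong suc (begin
        countE u + r                                  ≡⟨ cong (_+ r) (countE-++ pre _) ⟩
        β + countE (replicate r N ++ replicate c E ++ replicate (suc k) N) + r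
          ≡⟨ cong (λ t → β + t + r) (trans (countE-replicateN-++ r _)
               (trans (countE-replicateE-++ c _) (cong (c +_) (countE-replicateN (suc k))))) ⟩
        β + (c + 0) + r                               ≡⟨ reassoc β c r ⟩
        r + (c + β)                                   ≡⟨ cong (r +_) excess ⟨
        r + κ                                         ∎)
        where
        reassoc : ∀ β c r → β + (c + 0) + r ≡ r + (c + β)
        reassoc = solve-∀

    S-P : ∀ r k → suc r + k ≡ δ → S n (suc i) (P (suc r) k) ≡ just (P r (suc k))
    S-P r k eq = trans (S-P-unfold {r} {k} eq) (slide-both {r} {k} eq)

    iter-S-P : ∀ t {r k} → t + r + k ≡ δ → iter t (S n (suc i)) (just (P (t + r) k)) ≡ just (P r (t + k))
    iter-S-P zero    eq = refl
    iter-S-P (suc t) {r} {k} eq = begin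
      iter t (S n (suc i)) (S n (suc i) (P (suc t + r) k)) ≡⟨ cong (iter t (S n (suc i))) (S-P (t + r) k eq) ⟩
      iter t (S n (suc i)) (just (P (t + r) (suc k)))      ≡⟨ iter-S-P t (trans (+-suc (t + r) k) eq) ⟩
      just (P r (t + suc k))                               ≡⟨ cong (λ m → just (P r m)) (+-suc t k) ⟩
      just (P r (suc t + k))                               ∎

    iter-S-P-δ-0 : ∀ p → p ≤ δ → iter p (S n (suc i)) (just (P δ 0)) ≡ just (P (δ ∸ p) p)
    iter-S-P-δ-0 p p≤δ = begin
      iter p (S n (suc i)) (just (P δ 0))
        ≡⟨ cong (λ r → iter p (S n (suc i)) (just (P r 0))) (m+[n∸m]≡n p≤δ) ⟨
      iter p (S n (suc i)) (just (P (p + (δ ∸ p)) 0))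
        ≡⟨ iter-S-P p (trans (+-identityʳ _) (m+[n∸m]≡n p≤δ)) ⟩
      just (P (δ ∸ p) (p + 0))                         ≡⟨ cong (λ k → just (P (δ ∸ p) k)) (+-identityʳ p) ⟩
      just (P (δ ∸ p) p)                               ∎

    bounceComp-P-0-δ :
      bounceComp n (P 0 δ) ≡ take i (diffs bs) ++ c ∷ (δ + c) ∷ drop (suc (suc i)) (diffs bs)
    bounceComp-P-0-δ = begin
      diffs (bouncePoints n (P 0 δ))   ≡⟨ cong diffs (bouncePoints-P refl) ⟩
      diffs (setAt (suc i) κ bs)       ≡⟨ diffs-setAt i κ bs len ⟩
      take i (diffs bs) ++ (κ ∸ at bs i) ∷ (at bs (suc (suc i)) ∸ κ) ∷ drop (suc (suc i)) (diffs bs)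
        ≡⟨ cong₂ (λ a b → take i (diffs bs) ++ a ∷ b ∷ drop (suc (suc i)) (diffs bs)) first second ⟩
      take i (diffs bs) ++ c ∷ (δ + c) ∷ drop (suc (suc i)) (diffs bs) ∎
      where
      first : κ ∸ at bs i ≡ c
      first = trans (cong₂ _∸_ excess (sym β≡)) (m+n∸n≡m c β)
      second : at bs (suc (suc i)) ∸ κ ≡ δ + c
      second = trans (cong (_∸ κ) (trans b₂≡ (reassoc c δ κ))) (m+n∸n≡m (δ + c) κ)
        where
        reassoc : ∀ c δ κ → c + (δ + κ) ≡ δ + c + κ
        reassoc = solve-∀

  S-interpolates : ∀ δ {n i π} → π ≡ P δ 0 → IsDyck n π → suc i < length (bounceComp n π) →
    β ≡ at (bouncePoints n π) i → κ ≡ at (bouncePoints n π) i + c → c ≡ at (bounceComp n π) (suc i) →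
    (∀ p → p ≤ δ → iter p (S n (suc i)) (just π) ≡ just (P (δ ∸ p) p)) ×
    bounceComp n (P 0 δ) ≡ take i (bounceComp n π) ++ c ∷ (δ + c) ∷ drop (suc (suc i)) (bounceComp n π)
  S-interpolates δ {n} {i} refl d i<m β≡ κ≡ c≡ = iter-S-P-δ-0 , bounceComp-P-0-δ
    where
    len : suc (suc i) < length (bouncePoints n (P δ 0))
    len = length-diffs (bouncePoints n (P δ 0)) i<m
    open Swapping {n} {δ} {i} d (trans κ≡ (trans (cong (_+ c) (sym β≡)) (+-comm β c))) len β≡
                    (trans c≡ (at-diffs (bouncePoints n (P δ 0)) len))

proposition3p3 : (n : ℕ) (π : Path) → IsDyck n π →
  (i : ℕ) → 1 ≤ i → i < length (bounceComp n π) →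
  at (bounceComp n π) i < at (bounceComp n π) (i ∸ 1) →
  (pre post : Path) →
  π ≡ pre ++ replicate (at (bounceComp n π) (i ∸ 1) ∸ at (bounceComp n π) i) N
          ++ replicate (at (bounceComp n π) (i ∸ 1)) E
          ++ replicate (at (bounceComp n π) i) N ++ post →
  countE pre ≡ at (bouncePoints n π) (i ∸ 1) →
  countN pre ≡ at (bouncePoints n π) (i ∸ 1) + at (bounceComp n π) i →
  ((p : ℕ) → 1 ≤ p → p ≤ at (bounceComp n π) (i ∸ 1) ∸ at (bounceComp n π) i →
     iter p (S n i) (just π) ≢ nothing)
  × (iter (at (bounceComp n π) (i ∸ 1) ∸ at (bounceComp n π) i) (S n i) (just π)
       ≡ just (pre ++ replicate (at (bounceComp n π) i) E
                   ++ replicate (at (bounceComp n π) (i ∸ 1)) N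
                   ++ replicate (at (bounceComp n π) (i ∸ 1) ∸ at (bounceComp n π) i) E
                   ++ post))
  × (bouncePath n (pre ++ replicate (at (bounceComp n π) i) E
                   ++ replicate (at (bounceComp n π) (i ∸ 1)) N
                   ++ replicate (at (bounceComp n π) (i ∸ 1) ∸ at (bounceComp n π) i) E
                   ++ post)
       ≡ pathOfComp (take (i ∸ 1) (bounceComp n π)
                     ++ at (bounceComp n π) i ∷ at (bounceComp n π) (i ∸ 1)
                     ∷ drop (suc i) (bounceComp n π)))
proposition3p3 n π d (suc i) (s≤s z≤n) i<m αᵢ₊₁<αᵢ pre post π≡ β≡ κ≡ = reachable , final , bounce
  where
  α : List ℕ
  α = bounceComp n π
  a c δ : ℕ
  a = at α i
  c = at α (suc i)
  δ = a ∸ c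
  open Interpolation pre post c
  a≡δ+c : a ≡ δ + c
  a≡δ+c = sym (m∸n+n≡m (<⇒≤ αᵢ₊₁<αᵢ))
  π′≡P : pre ++ replicate c E ++ replicate a N ++ replicate δ E ++ post ≡ P 0 δ
  π′≡P = P-0-δ δ a a≡δ+c
  π≡P : π ≡ P δ 0
  π≡P = trans π≡ (P-δ-0 δ a (trans a≡δ+c (+-comm δ c)))
  steps : ∀ p → p ≤ δ → iter p (S n (suc i)) (just π) ≡ just (P (δ ∸ p) p)
  steps = proj₁ (S-interpolates δ π≡P d i<m β≡ κ≡ refl)
  swapped : bounceComp n (P 0 δ) ≡ take i α ++ c ∷ (δ + c) ∷ drop (suc (suc i)) α
  swapped = proj₂ (S-interpolates δ π≡P d i<m β≡ κ≡ refl)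
  reachable : ∀ p → 1 ≤ p → p ≤ δ → iter p (S n (suc i)) (just π) ≢ nothing
  reachable p _ p≤δ reaches-⊥ with trans (sym (steps p p≤δ)) reaches-⊥
  ... | ()
  final : iter δ (S n (suc i)) (just π) ≡ just (pre ++ replicate c E ++ replicate a N ++ replicate δ E ++ post)
  final = trans (steps δ ≤-refl) (cong just (trans (cong (λ r → P r δ) (n∸n≡0 δ)) (sym π′≡P)))
  bounce : bouncePath n (pre ++ replicate c E ++ replicate a N ++ replicate δ E ++ post) ≡
           pathOfComp (take i α ++ c ∷ a ∷ drop (suc (suc i)) α)
  bounce = cong pathOfComp (trans (cong (bounceComp n) π′≡P)
             (trans swapped (cong (λ m → take i α ++ c ∷ m ∷ drop (suc (suc i)) α) (sym a≡δ+c))))
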